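{- Let $N$ be an odd perfect number with prime factorization $N = p_1^{a_1} p_2^{a_2} \cdots p_k^{a_k}$, where $p_1 < p_2 < \cdots < p_k$ are primes and $a_i \ge 1$, and let $R = p_1 p_2 \cdots p_k$. Then there is an $i$ with $1 \le i \le k$ such that $$p_i^{a_i+1} \le kR + \sqrt{2kR} + k + 1.$$
   Context: A positive integer $N$ is perfect if $\sigma(N) = 2N$, where $\sigma(N)$ is the sum of the positive divisors of $N$. -}

module Defs where

open import Data.Nat using (ℕ; zero; suc; _+_; _*_; _^_; _≤_; _∸_)
open import Data.Nat.Divisibility using (_∣_; _∣?_)
open import Data.Nat.Primality using (Prime)
open import Data.List using (List; filter; upTo; map)
open import Data.Nat.ListAction using (sum)
open import Data.Fin using (Fin; zero; suc; _<_)
open import Data.Product using (_×_; ∃; ∃-syntax)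
open import Relation.Binary.PropositionalEquality using (_≡_)

divisors : ℕ → List ℕ
divisors n = filter (_∣? n) (map suc (upTo n))

σ : ℕ → ℕ
σ n = sum (divisors n)

Perfect : ℕ → Set
Perfect N = (1 ≤ N) × (σ N ≡ 2 * N)

Odd : ℕ → Set
Odd N = ∃[ m ] N ≡ 1 + 2 * m

∏ : (k : ℕ) → (Fin k → ℕ) → ℕ
∏ zero f = 1
∏ (suc k) f = f zero * ∏ k (λ i → f (suc i))

IsPrimeFactorization : ℕ → (k : ℕ) → (Fin k → ℕ) → (Fin k → ℕ) → Set
IsPrimeFactorization N k p a =
  (∀ i → Prime (p i)) ×
  (∀ i j → i < j → p i Data.Nat.< p j) ×
  (∀ i → 1 ≤ a i) ×
  (N ≡ ∏ k (λ i → p i ^ a i))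

-- For naturals x, c, d:  x ≤ c + √d  (real inequality)  ⇔  (x ∸ c)² ≤ d.
-- (If x ≤ c both sides hold; otherwise x - c > 0 and squaring is monotone.)
≤+√ : ℕ → ℕ → ℕ → Set
≤+√ x c d = (x ∸ c) * (x ∸ c) ≤ d

module Submission where

-- For a perfect number N = p₁^a₁ ⋯ p_k^a_k with R = p₁ ⋯ p_k we show that some
-- prime power satisfies p_i^(a_i+1) ≤ kR; this is stronger than the bound
-- kR + √(2kR) + k + 1 of the theorem.
--
-- Write xᵢ = pᵢ^(aᵢ+1), X = ∏ xᵢ = N R, Y = ∏ (xᵢ - 1) and Q = ∏ (pᵢ - 1).
-- (1) Multiplicativity of σ over prime powers gives σ(N) Q = Y, so σ(N) = 2N
--     yields R Y = 2 Q X.  Since Y < X this forces 2Q < R, hence R Y + X ≤ R X,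
--     i.e. R (X - Y) ≥ X.
-- (2) The Weierstrass product inequality ∏ (1 - 1/xᵢ) ≥ 1 - Σ 1/xᵢ, in the integer
--     form T X ≤ T Y + k X when every xᵢ ≥ T.  If every xᵢ ≥ kR + 1 this gives
--     (kR + 1)(X - Y) ≤ k X, which together with (1) forces X ≤ Y: impossible.

open import Defs
open import Data.Nat using (ℕ; suc; _+_; _*_; _^_)
open import Data.Fin using (Fin)
open import Data.Product using (∃-syntax)

open import Data.Nat using (zero; pred; _≤_; _<_; _∸_; NonZero; z≤n; s≤s; z<s; _≤?_; >-nonZero; >-nonZero⁻¹; ≢-nonZero⁻¹; nonTrivial⇒≢1)
open import Data.Nat.Properties
open import Data.Nat.Divisibility
open import Data.Nat.Primality
open import Data.Nat.Coprimality using (Coprime; coprime-divisor)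
open import Data.Nat.Tactic.RingSolver using (solve-∀)
open import Algebra.Properties.CommutativeSemigroup +-commutativeSemigroup using (interchange)
open import Data.List using ([]; _∷_; filter; map; upTo; _++_; [_])
open import Data.List.Properties using (upTo-∷ʳ; map-++)
open import Data.Nat.ListAction using (sum)
open import Data.Nat.ListAction.Properties using (sum-++)
open import Data.Fin using () renaming (zero to fzero; suc to fsuc; _<_ to _<ᶠ_)
open import Data.Fin.Properties using (any?)
open import Data.Sum using (inj₁; inj₂)
open import Data.Product using (_,_)
open import Relation.Nullary using (Dec; yes; no; ¬_; contradiction)
open import Relation.Unary using (Decidable)
open import Relation.Binary.PropositionalEquality hiding ([_])

sumTo : ℕ → (ℕ → ℕ) → ℕ
sumTo zero    g = 0
sumTo (suc n) g = sumTo n g + g (suc n)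

-- keepIf P? d is d if P holds and 0 otherwise; it turns filtered sums into plain ones.
keepIf : ∀ {A : Set} → Dec A → ℕ → ℕ
keepIf (yes _) d = d
keepIf (no _)  _ = 0

sum-filter : ∀ {P : ℕ → Set} (P? : Decidable P) xs →
             sum (filter P? xs) ≡ sum (map (λ d → keepIf (P? d) d) xs)
sum-filter P? []       = refl
sum-filter P? (x ∷ xs) with P? x
... | yes _ = cong (x +_) (sum-filter P? xs)
... | no _  = sum-filter P? xs

sum-over-1…n : ∀ g n → sum (map g (map suc (upTo n))) ≡ sumTo n g
sum-over-1…n g zero    = refl
sum-over-1…n g (suc n) = begin
  sum (map g (map suc (upTo (suc n))))
    ≡⟨ cong (λ l → sum (map g (map suc l))) (sym (upTo-∷ʳ n)) ⟩
  sum (map g (map suc (upTo n ++ [ n ])))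
    ≡⟨ cong (λ l → sum (map g l)) (map-++ suc (upTo n) [ n ]) ⟩
  sum (map g (map suc (upTo n) ++ [ suc n ]))
    ≡⟨ cong sum (map-++ g (map suc (upTo n)) [ suc n ]) ⟩
  sum (map g (map suc (upTo n)) ++ [ g (suc n) ])
    ≡⟨ sum-++ (map g (map suc (upTo n))) [ g (suc n) ] ⟩
  sum (map g (map suc (upTo n))) + (g (suc n) + 0)
    ≡⟨ cong₂ _+_ (sum-over-1…n g n) (+-identityʳ _) ⟩
  sumTo (suc n) g ∎
  where open ≡-Reasoning

σ-as-sumTo : ∀ n → σ n ≡ sumTo n (λ d → keepIf (d ∣? n) d)
σ-as-sumTo n = trans (sum-filter (_∣? n) (map suc (upTo n))) (sum-over-1…n _ n)

sumTo-cong : ∀ n {g h} → (∀ d → d < n → g (suc d) ≡ h (suc d)) → sumTo n g ≡ sumTo n h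
sumTo-cong zero    eq = refl
sumTo-cong (suc n) eq = cong₂ _+_ (sumTo-cong n (λ d d<n → eq d (m<n⇒m<1+n d<n))) (eq n ≤-refl)

sumTo-+ : ∀ n g h → sumTo n (λ d → g d + h d) ≡ sumTo n g + sumTo n h
sumTo-+ zero    g h = refl
sumTo-+ (suc n) g h =
  trans (cong (_+ (g (suc n) + h (suc n))) (sumTo-+ n g h))
        (interchange (sumTo n g) (sumTo n h) (g (suc n)) (h (suc n)))

sumTo-* : ∀ c n g → sumTo n (λ d → c * g d) ≡ c * sumTo n g
sumTo-* c zero    g = sym (*-zeroʳ c)
sumTo-* c (suc n) g =
  trans (cong (_+ c * g (suc n)) (sumTo-* c n g)) (sym (*-distribˡ-+ c (sumTo n g) _))

sumTo-vanishing-tail : ∀ s t g → (∀ r → r < t → g (s + suc r) ≡ 0) →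
                       sumTo (s + t) g ≡ sumTo s g
sumTo-vanishing-tail s zero    g _      = cong (λ x → sumTo x g) (+-identityʳ s)
sumTo-vanishing-tail s (suc t) g vanish = begin
  sumTo (s + suc t) g                ≡⟨ cong (λ x → sumTo x g) (+-suc s t) ⟩
  sumTo (s + t) g + g (suc (s + t))  ≡⟨ cong₂ _+_ earlier last ⟩
  sumTo s g + 0                      ≡⟨ +-identityʳ _ ⟩
  sumTo s g                          ∎
  where
  open ≡-Reasoning
  earlier : sumTo (s + t) g ≡ sumTo s g
  earlier = sumTo-vanishing-tail s t g (λ r r<t → vanish r (m<n⇒m<1+n r<t))
  last : g (suc (s + t)) ≡ 0
  last = trans (cong g (sym (+-suc s t))) (vanish t ≤-refl)

sumTo-multiples : ∀ p m g → .{{NonZero p}} → (∀ d → ¬ p ∣ d → g d ≡ 0) →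
                  sumTo (p * m) g ≡ sumTo m (λ e → g (p * e))
sumTo-multiples p zero    g _      = cong (λ x → sumTo x g) (*-zeroʳ p)
sumTo-multiples p (suc m) g vanish = begin
  sumTo (p * suc m) g
    ≡⟨ cong (λ x → sumTo x g) next-multiple ⟩
  sumTo (p * m + pred p) g + g (suc (p * m + pred p))
    ≡⟨ cong₂ _+_ (sumTo-vanishing-tail (p * m) (pred p) g gap) (cong g (sym next-multiple)) ⟩
  sumTo (p * m) g + g (p * suc m)
    ≡⟨ cong (_+ g (p * suc m)) (sumTo-multiples p m g vanish) ⟩
  sumTo (suc m) (λ e → g (p * e)) ∎
  where
  open ≡-Reasoning
  next-multiple : p * suc m ≡ suc (p * m + pred p)
  next-multiple = begin
    p * suc m                ≡⟨ trans (*-suc p m) (+-comm p (p * m)) ⟩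
    p * m + p                ≡⟨ cong (p * m +_) (sym (suc-pred p)) ⟩
    p * m + suc (pred p)     ≡⟨ +-suc (p * m) (pred p) ⟩
    suc (p * m + pred p)     ∎
  -- strictly between two consecutive multiples of p there is no multiple of p
  gap : ∀ r → r < pred p → g (p * m + suc r) ≡ 0
  gap r r<p-1 = vanish _ (λ p∣ → >⇒∤ r+1<p (∣m+n∣m⇒∣n p∣ (m∣m*n m)))
    where
    r+1<p : suc r < p
    r+1<p = subst (suc r <_) (suc-pred p) (s≤s r<p-1)

-- Splitting the divisors of n = p m by divisibility by p: if the divisors of n prime
-- to p are exactly the divisors of M, the others are the p e with e ∣ m.
σ-split : ∀ p M m n → .{{NonZero p}} → .{{NonZero M}} → M ≤ n → n ≡ p * m → ¬ p ∣ M →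
          (∀ {d} → d ∣ M → d ∣ n) → (∀ {d} → d ∣ n → ¬ p ∣ d → d ∣ M) →
          σ n ≡ σ M + p * σ m
σ-split p M m n M≤n n≡pm p∤M M∣⇒n∣ n∣⇒M∣ = begin
  σ n                                    ≡⟨ σ-as-sumTo n ⟩
  sumTo n divisor                        ≡⟨ sumTo-cong n (λ d _ → split (suc d)) ⟩
  sumTo n (λ d → multiple d + pFree d)   ≡⟨ sumTo-+ n multiple pFree ⟩
  sumTo n multiple + sumTo n pFree       ≡⟨ cong₂ _+_ multiples-sum pFree-sum ⟩
  p * σ m + σ M                          ≡⟨ +-comm _ (σ M) ⟩
  σ M + p * σ m                          ∎
  where
  open ≡-Reasoning
  divisor multiple pFree : ℕ → ℕ
  divisor d  = keepIf (d ∣? n) d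
  multiple d = keepIf (p ∣? d) (divisor d)
  pFree d    = keepIf (d ∣? M) d

  split : ∀ d → divisor d ≡ multiple d + pFree d
  split d with d ∣? n | p ∣? d | d ∣? M
  ... | yes _   | yes p∣d | yes d∣M = contradiction (∣-trans p∣d d∣M) p∤M
  ... | yes _   | yes _   | no _    = sym (+-identityʳ d)
  ... | yes _   | no _    | yes _   = refl
  ... | yes d∣n | no p∤d  | no d∤M  = contradiction (n∣⇒M∣ d∣n p∤d) d∤M
  ... | no d∤n  | _       | yes d∣M = contradiction (M∣⇒n∣ d∣M) d∤n
  ... | no _    | yes _   | no _    = refl
  ... | no _    | no _    | no _    = refl

  -- the p-free divisors contribute σ M: no divisor of M exceeds M
  pFree-sum : sumTo n pFree ≡ σ M
  pFree-sum = begin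
    sumTo n pFree              ≡⟨ cong (λ x → sumTo x pFree) (sym (m+[n∸m]≡n M≤n)) ⟩
    sumTo (M + (n ∸ M)) pFree  ≡⟨ sumTo-vanishing-tail M (n ∸ M) pFree beyond-M ⟩
    sumTo M pFree              ≡⟨ sym (σ-as-sumTo M) ⟩
    σ M                        ∎
    where
    beyond-M : ∀ r → r < n ∸ M → pFree (M + suc r) ≡ 0
    beyond-M r _ with (M + suc r) ∣? M
    ... | yes d∣M = contradiction (∣⇒≤ d∣M) (<⇒≱ (m<m+n M z<s))
    ... | no _    = refl

  -- the multiples of p contribute p σ m: p e ∣ n = p m iff e ∣ m
  multiples-sum : sumTo n multiple ≡ p * σ m
  multiples-sum = begin
    sumTo n multiple                             ≡⟨ cong (λ x → sumTo x multiple) n≡pm ⟩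
    sumTo (p * m) multiple                       ≡⟨ sumTo-multiples p m multiple non-multiple ⟩
    sumTo m (λ e → multiple (p * e))             ≡⟨ sumTo-cong m (λ e _ → scaled (suc e)) ⟩
    sumTo m (λ e → p * keepIf (e ∣? m) e)        ≡⟨ sumTo-* p m _ ⟩
    p * sumTo m (λ e → keepIf (e ∣? m) e)        ≡⟨ cong (p *_) (sym (σ-as-sumTo m)) ⟩
    p * σ m                                      ∎
    where
    non-multiple : ∀ d → ¬ p ∣ d → multiple d ≡ 0
    non-multiple d p∤d with p ∣? d
    ... | yes p∣d = contradiction p∣d p∤d
    ... | no _    = refl
    scaled : ∀ e → multiple (p * e) ≡ p * keepIf (e ∣? m) e
    scaled e with p ∣? (p * e)
    ... | no p∤pe = contradiction (m∣m*n e) p∤pe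
    ... | yes _ with (p * e) ∣? n | e ∣? m
    ...   | yes _    | yes _   = refl
    ...   | yes pe∣n | no e∤m  = contradiction (*-cancelˡ-∣ p (subst (p * e ∣_) n≡pm pe∣n)) e∤m
    ...   | no pe∤n  | yes e∣m = contradiction (subst (p * e ∣_) (sym n≡pm) (*-monoʳ-∣ p e∣m)) pe∤n
    ...   | no _     | no _    = sym (*-zeroʳ p)

∤prime⇒coprime : ∀ {p d} → Prime p → ¬ p ∣ d → Coprime d p
∤prime⇒coprime prime-p p∤d (c∣d , c∣p) with prime⇒irreducible prime-p c∣p
... | inj₁ c≡1 = c≡1
... | inj₂ refl = contradiction c∣d p∤d

p-free-divisor : ∀ {p d} M → Prime p → ¬ p ∣ d → ∀ a → d ∣ p ^ a * M → d ∣ M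
p-free-divisor {d = d} M prime-p p∤d zero    d∣ = subst (d ∣_) (*-identityˡ M) d∣
p-free-divisor {p} {d} M prime-p p∤d (suc a) d∣ =
  p-free-divisor M prime-p p∤d a
    (coprime-divisor (∤prime⇒coprime prime-p p∤d) (subst (d ∣_) (*-assoc p (p ^ a) M) d∣))

σ-peel : ∀ {p} a M → Prime p → .{{NonZero M}} → ¬ p ∣ M →
         σ (p ^ suc a * M) ≡ σ M + p * σ (p ^ a * M)
σ-peel {p} a M prime-p p∤M =
  σ-split p M (p ^ a * M) (p ^ suc a * M) (m≤n*m M (p ^ suc a) {{m^n≢0 p (suc a)}}) (*-assoc p (p ^ a) M) p∤M
    (∣n⇒∣m*n (p ^ suc a)) (λ d∣ p∤d → p-free-divisor M prime-p p∤d (suc a) d∣)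
  where
  instance
    p≢0 : NonZero p
    p≢0 = prime⇒nonZero prime-p

-- Iterating σ-peel, in subtraction-free form:  σ(p^a M)(p - 1) + σ(M) = σ(M) p^(a+1).
σ-geometric : ∀ {p} a M → Prime p → .{{NonZero M}} → ¬ p ∣ M →
              σ (p ^ a * M) * (p ∸ 1) + σ M ≡ σ M * p ^ suc a
σ-geometric {zero}  _ _ prime-0 _ = contradiction refl (≢-nonZero⁻¹ 0 {{prime⇒nonZero prime-0}})
σ-geometric {suc q} zero M _ _ rewrite *-identityˡ M = base (σ M) q
  where
  base : ∀ c q → c * q + c ≡ c * (suc q * 1)
  base = solve-∀
σ-geometric {suc q} (suc a) M prime-p p∤M = begin
  σ (p ^ suc a * M) * q + σ M        ≡⟨ cong (λ s → s * q + σ M) (σ-peel a M prime-p p∤M) ⟩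
  (σ M + p * σ (p ^ a * M)) * q + σ M ≡⟨ regroup (σ M) q (σ (p ^ a * M)) ⟩
  p * (σ (p ^ a * M) * q + σ M)       ≡⟨ cong (p *_) (σ-geometric a M prime-p p∤M) ⟩
  p * (σ M * p ^ suc a)               ≡⟨ *-comm-left p (σ M) (p ^ suc a) ⟩
  σ M * p ^ suc (suc a)               ∎
  where
  open ≡-Reasoning
  p = suc q
  regroup : ∀ c q s → (c + suc q * s) * q + c ≡ suc q * (s * q + c)
  regroup = solve-∀
  *-comm-left : ∀ x y z → x * (y * z) ≡ y * (x * z)
  *-comm-left = solve-∀

σ-prime-power : ∀ {p} a M → Prime p → .{{NonZero M}} → ¬ p ∣ M →
                σ (p ^ a * M) * (p ∸ 1) ≡ σ M * (p ^ suc a ∸ 1)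
σ-prime-power {p} a M prime-p p∤M = begin
  σ (p ^ a * M) * (p ∸ 1)                 ≡⟨ sym (m+n∸n≡m _ (σ M)) ⟩
  σ (p ^ a * M) * (p ∸ 1) + σ M ∸ σ M     ≡⟨ cong (_∸ σ M) (σ-geometric a M prime-p p∤M) ⟩
  σ M * p ^ suc a ∸ σ M                   ≡⟨ cong (σ M * p ^ suc a ∸_) (sym (*-identityʳ (σ M))) ⟩
  σ M * p ^ suc a ∸ σ M * 1               ≡⟨ sym (*-distribˡ-∸ (σ M) (p ^ suc a) 1) ⟩
  σ M * (p ^ suc a ∸ 1)                   ∎
  where open ≡-Reasoning

∏-cong : ∀ k {f g : Fin k → ℕ} → (∀ i → f i ≡ g i) → ∏ k f ≡ ∏ k g
∏-cong zero    eq = refl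
∏-cong (suc k) eq = cong₂ _*_ (eq fzero) (∏-cong k (λ i → eq (fsuc i)))

∏-* : ∀ k (f g : Fin k → ℕ) → ∏ k f * ∏ k g ≡ ∏ k (λ i → f i * g i)
∏-* zero    f g = refl
∏-* (suc k) f g =
  trans (interchange-* (f fzero) _ (g fzero) _) (cong (f fzero * g fzero *_) (∏-* k _ _))
  where
  interchange-* : ∀ a b c d → (a * b) * (c * d) ≡ (a * c) * (b * d)
  interchange-* = solve-∀

∏-mono-≤ : ∀ k {f g : Fin k → ℕ} → (∀ i → f i ≤ g i) → ∏ k f ≤ ∏ k g
∏-mono-≤ zero    le = ≤-refl
∏-mono-≤ (suc k) le = *-mono-≤ (le fzero) (∏-mono-≤ k (λ i → le (fsuc i)))

∏-nonZero : ∀ k (f : Fin k → ℕ) → (∀ i → NonZero (f i)) → NonZero (∏ k f)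
∏-nonZero zero    f nz = _
∏-nonZero (suc k) f nz =
  m*n≢0 (f fzero) (∏ k (λ i → f (fsuc i))) {{nz fzero}} {{∏-nonZero k _ (λ i → nz (fsuc i))}}

prime∤∏ : ∀ {p} → Prime p → ∀ k (f : Fin k → ℕ) → (∀ i → ¬ p ∣ f i) → ¬ p ∣ ∏ k f
prime∤∏ prime-p zero    f p∤f p∣1 = nonTrivial⇒≢1 {{prime⇒nonTrivial prime-p}} (∣1⇒≡1 p∣1)
prime∤∏ prime-p (suc k) f p∤f p∣ with euclidsLemma (f fzero) _ prime-p p∣
... | inj₁ p∣head = p∤f fzero p∣head
... | inj₂ p∣rest = prime∤∏ prime-p k _ (λ i → p∤f (fsuc i)) p∣rest

prime∣^⇒∣ : ∀ {p q} → Prime p → ∀ a → p ∣ q ^ a → p ∣ q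
prime∣^⇒∣ prime-p zero    p∣1 = contradiction (∣1⇒≡1 p∣1) (nonTrivial⇒≢1 {{prime⇒nonTrivial prime-p}})
prime∣^⇒∣ {q = q} prime-p (suc a) p∣ with euclidsLemma q (q ^ a) prime-p p∣
... | inj₁ p∣q = p∣q
... | inj₂ p∣q^a = prime∣^⇒∣ prime-p a p∣q^a

prime∤larger-prime^ : ∀ {p q} → Prime p → Prime q → p < q → ∀ a → ¬ p ∣ q ^ a
prime∤larger-prime^ prime-p prime-q p<q a p∣ with prime⇒irreducible prime-q (prime∣^⇒∣ prime-p a p∣)
... | inj₁ refl = nonTrivial⇒≢1 {{prime⇒nonTrivial prime-p}} refl
... | inj₂ refl = <-irrefl refl p<q

σ-∏ : ∀ k (p a : Fin k → ℕ) → (∀ i → Prime (p i)) → (∀ i j → i <ᶠ j → p i < p j) →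
      σ (∏ k (λ i → p i ^ a i)) * ∏ k (λ i → p i ∸ 1) ≡ ∏ k (λ i → p i ^ suc (a i) ∸ 1)
σ-∏ zero    p a primes increasing = refl
σ-∏ (suc k) p a primes increasing = begin
  σ (p₀ ^ a₀ * M) * ((p₀ ∸ 1) * Q)       ≡⟨ sym (*-assoc (σ (p₀ ^ a₀ * M)) _ Q) ⟩
  σ (p₀ ^ a₀ * M) * (p₀ ∸ 1) * Q         ≡⟨ cong (_* Q) (σ-prime-power a₀ M (primes fzero) p₀∤M) ⟩
  σ M * (p₀ ^ suc a₀ ∸ 1) * Q            ≡⟨ cong (_* Q) (*-comm (σ M) _) ⟩
  (p₀ ^ suc a₀ ∸ 1) * σ M * Q            ≡⟨ *-assoc (p₀ ^ suc a₀ ∸ 1) (σ M) Q ⟩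
  (p₀ ^ suc a₀ ∸ 1) * (σ M * Q)          ≡⟨ cong ((p₀ ^ suc a₀ ∸ 1) *_) rest ⟩
  ∏ (suc k) (λ i → p i ^ suc (a i) ∸ 1)  ∎
  where
  open ≡-Reasoning
  p₀ = p fzero
  a₀ = a fzero
  M = ∏ k (λ i → p (fsuc i) ^ a (fsuc i))
  Q = ∏ k (λ i → p (fsuc i) ∸ 1)
  rest : σ M * Q ≡ ∏ k (λ i → p (fsuc i) ^ suc (a (fsuc i)) ∸ 1)
  rest = σ-∏ k (λ i → p (fsuc i)) (λ i → a (fsuc i)) (λ i → primes (fsuc i))
           (λ i j i<j → increasing (fsuc i) (fsuc j) (s≤s i<j))
  instance
    M≢0 : NonZero M
    M≢0 = ∏-nonZero k _ (λ i → m^n≢0 (p (fsuc i)) (a (fsuc i)) {{prime⇒nonZero (primes (fsuc i))}})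
  p₀∤M : ¬ p₀ ∣ M
  p₀∤M = prime∤∏ (primes fzero) k _
           (λ i → prime∤larger-prime^ (primes fzero) (primes (fsuc i))
                    (increasing fzero (fsuc i) (s≤s z≤n)) (a (fsuc i)))

-- The Weierstrass product inequality ∏ (1 - 1/xᵢ) ≥ 1 - Σ 1/xᵢ, specialised to all
-- xᵢ ≥ T and cleared of denominators:  T ∏ xᵢ ≤ T ∏ (xᵢ - 1) + m ∏ xᵢ.
weierstrass : ∀ m (x : Fin m → ℕ) T → (∀ i → T ≤ x i) →
              T * ∏ m x ≤ T * ∏ m (λ i → x i ∸ 1) + m * ∏ m x
weierstrass zero    x T _   = m≤m+n (T * 1) 0
weierstrass (suc m) x T T≤x = step (x fzero) (T≤x fzero)
  where
  X = ∏ m (λ i → x (fsuc i))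
  Y = ∏ m (λ i → x (fsuc i) ∸ 1)
  ih : T * X ≤ T * Y + m * X
  ih = weierstrass m (λ i → x (fsuc i)) T (λ i → T≤x (fsuc i))
  Y≤X : Y ≤ X
  Y≤X = ∏-mono-≤ m (λ i → m∸n≤m (x (fsuc i)) 1)
  pull-out : ∀ T z X → T * (suc z * X) ≡ suc z * (T * X)
  pull-out = solve-∀
  expand : ∀ T z Y m X → suc z * (T * Y + m * X) ≡ z * (T * Y) + T * Y + m * (suc z * X)
  expand = solve-∀
  collect : ∀ T z Y m X → z * (T * Y) + suc z * X + m * (suc z * X) ≡ T * (z * Y) + suc m * (suc z * X)
  collect = solve-∀
  step : ∀ x₀ → T ≤ x₀ → T * (x₀ * X) ≤ T * ((x₀ ∸ 1) * Y) + suc m * (x₀ * X)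
  step zero    _    = ≤-trans (≤-reflexive (*-zeroʳ T)) z≤n
  step (suc z) T≤x₀ = begin
    T * (suc z * X)                            ≡⟨ pull-out T z X ⟩
    suc z * (T * X)                            ≤⟨ *-monoʳ-≤ (suc z) ih ⟩
    suc z * (T * Y + m * X)                    ≡⟨ expand T z Y m X ⟩
    z * (T * Y) + T * Y + m * (suc z * X)      ≤⟨ +-monoˡ-≤ (m * (suc z * X)) (+-monoʳ-≤ (z * (T * Y)) (*-mono-≤ T≤x₀ Y≤X)) ⟩
    z * (T * Y) + suc z * X + m * (suc z * X)  ≡⟨ collect T z Y m X ⟩
    T * (z * Y) + suc m * (suc z * X)          ∎
    where open ≤-Reasoning

∏-pred<∏ : ∀ k (x : Fin (suc k) → ℕ) → (∀ i → 1 ≤ x i) →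
           ∏ (suc k) (λ i → x i ∸ 1) < ∏ (suc k) x
∏-pred<∏ k x x≥1 = head-step (x fzero) (x≥1 fzero)
  where
  X = ∏ k (λ i → x (fsuc i))
  Y = ∏ k (λ i → x (fsuc i) ∸ 1)
  instance
    X≢0 : NonZero X
    X≢0 = ∏-nonZero k _ (λ i → >-nonZero (x≥1 (fsuc i)))
  head-step : ∀ x₀ → 1 ≤ x₀ → (x₀ ∸ 1) * Y < x₀ * X
  head-step (suc z) _ =
    ≤-<-trans (*-monoʳ-≤ z (∏-mono-≤ k (λ i → m∸n≤m (x (fsuc i)) 1))) (*-monoˡ-< X (n<1+n z))

squeeze : ∀ K X Y R → suc (K * R) * X ≤ suc (K * R) * Y + K * X → R * Y + X ≤ R * X → X ≤ Y
squeeze K X Y R weierstrass-bound deficiency = +-cancelˡ-≤ (K * R * X + K * R * Y + K * X) X Y (begin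
  (K * R * X + K * R * Y + K * X) + X    ≡⟨ left K X Y R ⟩
  suc (K * R) * X + K * (R * Y + X)      ≤⟨ +-monoʳ-≤ (suc (K * R) * X) (*-monoʳ-≤ K deficiency) ⟩
  suc (K * R) * X + K * (R * X)          ≤⟨ +-monoˡ-≤ (K * (R * X)) weierstrass-bound ⟩
  suc (K * R) * Y + K * X + K * (R * X)  ≡⟨ right K X Y R ⟩
  (K * R * X + K * R * Y + K * X) + Y    ∎)
  where
  open ≤-Reasoning
  left : ∀ K X Y R → (K * R * X + K * R * Y + K * X) + X ≡ suc (K * R) * X + K * (R * Y + X)
  left = solve-∀
  right : ∀ K X Y R → suc (K * R) * Y + K * X + K * (R * X) ≡ (K * R * X + K * R * Y + K * X) + Y
  right = solve-∀

-- Perfection in product form:  R Y = 2 Q X,  where R = ∏ pᵢ, Q = ∏ (pᵢ - 1),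
-- X = ∏ pᵢ^(aᵢ+1) = N R and Y = ∏ (pᵢ^(aᵢ+1) - 1) = σ(N) Q.
perfect-identity : ∀ N → σ N ≡ 2 * N → ∀ k p a → IsPrimeFactorization N k p a →
                   ∏ k p * ∏ k (λ i → p i ^ suc (a i) ∸ 1)
                     ≡ 2 * ∏ k (λ i → p i ∸ 1) * ∏ k (λ i → p i ^ suc (a i))
perfect-identity N σN≡2N k p a (primes , increasing , _ , N≡∏) = begin
  R * Y                ≡⟨ cong (R *_) (sym σN*Q≡Y) ⟩
  R * (σ N * Q)        ≡⟨ cong (λ s → R * (s * Q)) σN≡2N ⟩
  R * (2 * N * Q)      ≡⟨ rearrange R N Q ⟩
  2 * Q * (N * R)      ≡⟨ cong (2 * Q *_) N*R≡X ⟩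
  2 * Q * X            ∎
  where
  open ≡-Reasoning
  R = ∏ k p
  Q = ∏ k (λ i → p i ∸ 1)
  X = ∏ k (λ i → p i ^ suc (a i))
  Y = ∏ k (λ i → p i ^ suc (a i) ∸ 1)
  σN*Q≡Y : σ N * Q ≡ Y
  σN*Q≡Y = trans (cong (λ n → σ n * Q) N≡∏) (σ-∏ k p a primes increasing)
  N*R≡X : N * R ≡ X
  N*R≡X = begin
    N * R                              ≡⟨ cong (_* R) N≡∏ ⟩
    ∏ k (λ i → p i ^ a i) * R          ≡⟨ ∏-* k (λ i → p i ^ a i) p ⟩
    ∏ k (λ i → p i ^ a i * p i)        ≡⟨ ∏-cong k (λ i → *-comm (p i ^ a i) (p i)) ⟩
    X                                  ∎
  rearrange : ∀ R N Q → R * (2 * N * Q) ≡ 2 * Q * (N * R)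
  rearrange = solve-∀

perfect⇒small-prime-power : ∀ N → Perfect N → ∀ k p a → IsPrimeFactorization N k p a →
                            ∃[ i ] p i ^ suc (a i) ≤ k * ∏ k p
perfect⇒small-prime-power N (_ , σN≡2N) zero p a (_ , _ , _ , refl) = contradiction σN≡2N (λ ())
perfect⇒small-prime-power N (_ , σN≡2N) (suc k) p a factorization@(primes , _ , _ , _)
  with any? (λ i → p i ^ suc (a i) ≤? suc k * ∏ (suc k) p)
... | yes small = small
... | no ¬small = contradiction (squeeze K X Y R weierstrass-bound deficiency) (<⇒≱ Y<X)
  where
  K = suc k
  R = ∏ K p
  Q = ∏ K (λ i → p i ∸ 1)
  x : Fin K → ℕ
  x i = p i ^ suc (a i)
  X = ∏ K x
  Y = ∏ K (λ i → x i ∸ 1)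
  Y<X : Y < X
  Y<X = ∏-pred<∏ k x (λ i → >-nonZero⁻¹ (x i) {{m^n≢0 (p i) (suc (a i)) {{prime⇒nonZero (primes i)}}}})
  instance
    R≢0 : NonZero R
    R≢0 = ∏-nonZero K p (λ i → prime⇒nonZero (primes i))
  -- R Y = 2 Q X together with Y < X gives 2 Q < R, i.e. R (X - Y) ≥ X
  2Q<R : 2 * Q < R
  2Q<R = *-cancelʳ-< X (2 * Q) R
           (subst (_< R * X) (perfect-identity N σN≡2N K p a factorization) (*-monoʳ-< R Y<X))
  deficiency : R * Y + X ≤ R * X
  deficiency = subst (_≤ R * X)
    (trans (+-comm X (2 * Q * X)) (cong (_+ X) (sym (perfect-identity N σN≡2N K p a factorization))))
    (*-monoˡ-≤ X 2Q<R)
  -- every prime power exceeds K R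
  weierstrass-bound : suc (K * R) * X ≤ suc (K * R) * Y + K * X
  weierstrass-bound = weierstrass K x (suc (K * R)) (λ i → ≰⇒> (λ le → ¬small (i , le)))

≤⇒≤+√ : ∀ {x c} d → x ≤ c → ≤+√ x c d
≤⇒≤+√ d x≤c rewrite m≤n⇒m∸n≡0 x≤c = z≤n

mainTheorem4 : (N : ℕ) → Odd N → Perfect N →
    (k : ℕ) (p a : Fin k → ℕ) → IsPrimeFactorization N k p a →
    let R = ∏ k p in
    ∃[ i ] ≤+√ (p i ^ suc (a i)) (k * R + k + 1) (2 * k * R)
mainTheorem4 N _ perfect k p a factorization =
  let (i , small) = perfect⇒small-prime-power N perfect k p a factorization
  in  i , ≤⇒≤+√ (2 * k * R) (≤-trans small kR≤bound)
  where
  R = ∏ k p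
  kR≤bound : k * R ≤ k * R + k + 1
  kR≤bound = ≤-trans (m≤m+n (k * R) k) (m≤m+n (k * R + k) 1)
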